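{- For $n\ge0$ let $\gamma_n$ be the exponent of the highest power of $2$ dividing $n!$, and let $\bar\gamma_n=\gamma_n \bmod 2$. Then the running sum $\mathrm{sum}_{\bar\gamma}(n)=\sum_{i=0}^{n}\bar\gamma_i$ is $2$-synchronised.
   Context: A function $f:\mathbb{N}\to\mathbb{N}$ is $2$-synchronised if there is a finite automaton which, reading the base-$2$ representations of $n$ and $m$ in parallel (the shorter padded with zeros on the most significant side), accepts exactly the pairs $(n,m)$ with $m=f(n)$. -}

module Defs where

open import Data.Nat using (ℕ; zero; suc; _+_; _^_; _⊔_; _≡ᵇ_; _!)
open import Data.Nat.DivMod using (_/_; _%_)
open import Data.Nat.Logarithm using (⌈log₂_⌉)
open import Data.Nat.Divisibility using (_∣_)
open import Data.Bool using (Bool; true)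
open import Data.Fin using (Fin)
open import Data.List using (List; []; _∷_; _++_; [_]; zip; foldl)
open import Data.Product using (_×_; Σ)
open import Relation.Binary.PropositionalEquality using (_≡_)
open import Relation.Nullary using (¬_)

-- number of binary digits of n (0 has the empty representation)
bitLength : ℕ → ℕ
bitLength n = ⌈log₂ suc n ⌉

-- the L lowest binary digits of n, most significant first
-- (zero-padded on the most significant side when L exceeds bitLength n)
toBits : ℕ → ℕ → List Bool
toBits zero    n = []
toBits (suc L) n = toBits L (n / 2) ++ [ n % 2 ≡ᵇ 1 ]

pairWord : ℕ → ℕ → List (Bool × Bool)
pairWord n m = zip (toBits L n) (toBits L m)
  where L = bitLength n ⊔ bitLength m

record DFA : Set where
  field
    nStates : ℕ
    start   : Fin nStates
    δ       : Fin nStates → Bool × Bool → Fin nStates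
    accept  : Fin nStates → Bool

accepts : DFA → List (Bool × Bool) → Bool
accepts A w = accept (foldl δ start w)
  where open DFA A

infix 3 _⇔_
_⇔_ : Set → Set → Set
P ⇔ Q = (P → Q) × (Q → P)

Synchronised₂ : (ℕ → ℕ) → Set
Synchronised₂ f = Σ DFA λ A → ∀ n m → (accepts A (pairWord n m) ≡ true) ⇔ (m ≡ f n)

Is2AdicValOfFactorial : (ℕ → ℕ) → Set
Is2AdicValOfFactorial γ = ∀ n → (2 ^ γ n ∣ n !) × ¬ (2 ^ suc (γ n) ∣ n !)

runningSum : (ℕ → ℕ) → ℕ → ℕ
runningSum g zero    = g 0
runningSum g (suc n) = runningSum g n + g (suc n)

-- Legendre's recurrence γ(2x + b) = x + γ(x) gives γ̄(2x + b) = t(x), where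
-- t(a) = (a + γ(a)) mod 2 satisfies t(2a + h) = h ⊕ t(a).  So on each block
-- 4a, …, 4a + 3 the values of γ̄ are t, t, ¬t, ¬t with t = t(a): every block
-- contributes 2, and sum(4a + 2h + l) = 2a + c with c ∈ {0, 1, 2} depending only
-- on h, l and t(a).  Reading n and m from the most significant bit, an automaton
-- keeps, for the prefixes read so far, the two low bits of n, the excess
-- m − 2⌊n/4⌋ as long as it stays in {0, 1, 2}, and t(⌊n/4⌋); it accepts when the
-- excess equals c.

{-# OPTIONS --safe #-}
module Submission where

open import Data.Bool using (Bool; true; false; not; _xor_; _∧_)
open import Data.Bool.Properties using (not-involutive; not-distribˡ-xor; xor-same; ∧-zeroʳ; T-≡)
open import Data.Empty using (⊥-elim)
open import Data.Fin using (Fin; toℕ; fromℕ<)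
open import Data.Fin.Patterns using (0F; 1F; 2F)
open import Data.Fin.Properties using (toℕ-fromℕ<)
open import Data.List using (List; []; _∷_; _++_; [_]; zip; foldl; length; lookup; map; cartesianProduct; allFin)
open import Data.List.Membership.Propositional using (_∈_)
open import Data.List.Membership.Propositional.Properties using (∈-cartesianProduct⁺; ∈-map⁺; ∈-allFin)
open import Data.List.Properties using (foldl-++; length-++)
open import Data.List.Relation.Unary.Any using (here; there; index)
open import Data.List.Relation.Unary.Any.Properties using (lookup-index)
open import Data.Maybe using (Maybe; just; nothing; _>>=_)
import Data.Maybe as Maybe
open import Data.Maybe.Relation.Unary.All using (All; just; nothing)
open import Data.Maybe.Relation.Unary.Any using (Any; just)
open import Data.Nat using (ℕ; zero; suc; _+_; _*_; _^_; _≤_; _<_; z≤n; s≤s; _⊔_; _!; _≡ᵇ_; ⌈_/2⌉)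
open import Data.Nat.Divisibility using (_∣_; divides; ∣-trans; m∣m*n; *-monoʳ-∣; *-monoˡ-∣; *-cancelˡ-∣; 1∣_)
open import Data.Nat.DivMod using (_/_; _%_; m≡m%n+[m/n]*n; m*n/n≡m; +-distrib-/-∣ʳ; m<n*o⇒m/o<n)
open import Data.Nat.Induction using (<-wellFounded)
open import Data.Nat.Logarithm.Core using (⌈log2⌉)
open import Data.Nat.Properties
open import Data.Nat.Tactic.RingSolver using (solve-∀)
open import Data.Product using (∃; _×_; _,_; proj₁; proj₂)
open import Function.Bundles using (Equivalence)
open import Induction.WellFounded using (Acc; acc)
open import Relation.Binary using (tri<; tri≈; tri>)
open import Relation.Binary.PropositionalEquality using (_≡_; refl; sym; trans; cong; cong₂; subst; subst₂; module ≡-Reasoning)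
open import Relation.Nullary using (¬_)

open import Defs

digit : Bool → ℕ
digit false = 0
digit true  = 1

odd : ℕ → Bool
odd zero    = false
odd (suc n) = not (odd n)

odd-+ : ∀ m n → odd (m + n) ≡ odd m xor odd n
odd-+ zero    n = refl
odd-+ (suc m) n = trans (cong not (odd-+ m n)) (not-distribˡ-xor (odd m) (odd n))

odd-* : ∀ m n → odd (m * n) ≡ odd m ∧ odd n
odd-* zero    n = refl
odd-* (suc m) n =
  trans (odd-+ n (m * n)) (trans (cong (odd n xor_) (odd-* m n)) (y⊕[x∧y]≡¬x∧y (odd m) (odd n)))
  where
  y⊕[x∧y]≡¬x∧y : ∀ x y → y xor (x ∧ y) ≡ not x ∧ y
  y⊕[x∧y]≡¬x∧y true  y     = xor-same y
  y⊕[x∧y]≡¬x∧y false false = refl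
  y⊕[x∧y]≡¬x∧y false true  = refl

odd[x*2]≡false : ∀ x → odd (x * 2) ≡ false
odd[x*2]≡false x = trans (odd-* x 2) (∧-zeroʳ (odd x))

odd[b+x*2]≡b : ∀ b x → odd (digit b + x * 2) ≡ b
odd[b+x*2]≡b false x = odd[x*2]≡false x
odd[b+x*2]≡b true  x = cong not (odd[x*2]≡false x)

[b+x*2]/2≡x : ∀ b x → (digit b + x * 2) / 2 ≡ x
[b+x*2]/2≡x false x = m*n/n≡m x 2
[b+x*2]/2≡x true  x = trans (+-distrib-/-∣ʳ 1 {d = 2} (divides x refl)) (m*n/n≡m x 2)

n%2≡digit∘odd : ∀ n → n % 2 ≡ digit (odd n)
n%2≡digit∘odd zero          = refl
n%2≡digit∘odd (suc zero)    = refl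
n%2≡digit∘odd (suc (suc n)) = trans (n%2≡digit∘odd n) (cong digit (sym (not-involutive (odd n))))

[n%2≡ᵇ1]≡odd : ∀ n → (n % 2 ≡ᵇ 1) ≡ odd n
[n%2≡ᵇ1]≡odd zero          = refl
[n%2≡ᵇ1]≡odd (suc zero)    = refl
[n%2≡ᵇ1]≡odd (suc (suc n)) = trans ([n%2≡ᵇ1]≡odd n) (sym (not-involutive (odd n)))

n≡odd+[n/2]*2 : ∀ n → n ≡ digit (odd n) + n / 2 * 2
n≡odd+[n/2]*2 n = trans (m≡m%n+[m/n]*n n 2) (cong (_+ n / 2 * 2) (n%2≡digit∘odd n))

halving-unique : ∀ {n} b x → n ≡ digit b + x * 2 → n / 2 ≡ x × odd n ≡ b
halving-unique b x refl = [b+x*2]/2≡x b x , odd[b+x*2]≡b b x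

n≤2^⌈log2⌉n : ∀ n (rs : Acc _<_ n) → n ≤ 2 ^ ⌈log2⌉ n rs
n≤2^⌈log2⌉n zero          _        = z≤n
n≤2^⌈log2⌉n (suc zero)    _        = s≤s z≤n
n≤2^⌈log2⌉n (suc (suc k)) (acc rs) = begin
  suc (suc k)           ≤⟨ s≤s (s≤s k≤c+c) ⟩
  suc (suc (c + c))     ≡⟨ solve-2[1+c] c ⟩
  2 * suc c             ≤⟨ *-monoʳ-≤ 2 (n≤2^⌈log2⌉n (suc c) (rs (⌈n/2⌉<n k))) ⟩
  2 * 2 ^ ⌈log2⌉ (suc c) (rs (⌈n/2⌉<n k)) ∎
  where
  open ≤-Reasoning
  c = ⌈ k /2⌉
  k≤c+c : k ≤ c + c
  k≤c+c = ≤-trans (≤-reflexive (sym (⌊n/2⌋+⌈n/2⌉≡n k))) (+-monoˡ-≤ c (⌊n/2⌋≤⌈n/2⌉ k))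
  solve-2[1+c] : ∀ c → suc (suc (c + c)) ≡ 2 * suc c
  solve-2[1+c] = solve-∀

n<2^bitLength : ∀ n → n < 2 ^ bitLength n
n<2^bitLength n = n≤2^⌈log2⌉n (suc n) (<-wellFounded (suc n))

padded-bounds : ∀ n m → n < 2 ^ (bitLength n ⊔ bitLength m) × m < 2 ^ (bitLength n ⊔ bitLength m)
padded-bounds n m = <-≤-trans (n<2^bitLength n) (^-monoʳ-≤ 2 (m≤m⊔n (bitLength n) (bitLength m)))
                  , <-≤-trans (n<2^bitLength m) (^-monoʳ-≤ 2 (m≤n⊔m (bitLength n) (bitLength m)))

IsVal₂ : ℕ → ℕ → Set
IsVal₂ X e = 2 ^ e ∣ X × ¬ (2 ^ suc e ∣ X)

^-monoʳ-∣ : ∀ b {m n} → m ≤ n → b ^ m ∣ b ^ n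
^-monoʳ-∣ b {n = n} z≤n = 1∣ (b ^ n)
^-monoʳ-∣ b (s≤s m≤n)   = *-monoʳ-∣ b (^-monoʳ-∣ b m≤n)

IsVal₂-unique : ∀ {X e f} → IsVal₂ X e → IsVal₂ X f → e ≡ f
IsVal₂-unique {e = e} {f} (2^e∣X , 2^1+e∤X) (2^f∣X , 2^1+f∤X) with <-cmp e f
... | tri< e<f _ _ = ⊥-elim (2^1+e∤X (∣-trans (^-monoʳ-∣ 2 e<f) 2^f∣X))
... | tri≈ _ e≡f _ = e≡f
... | tri> _ _ f<e = ⊥-elim (2^1+f∤X (∣-trans (^-monoʳ-∣ 2 f<e) 2^e∣X))

odd⇒2∤ : ∀ {q} → odd q ≡ true → ¬ (2 ∣ q)
odd⇒2∤ odd-q (divides k q≡k*2) with trans (sym odd-q) (trans (cong odd q≡k*2) (odd[x*2]≡false k))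
... | ()

IsVal₂-oddPart : ∀ e {q} → odd q ≡ true → IsVal₂ (2 ^ e * q) e
IsVal₂-oddPart e {q} odd-q = m∣m*n q , λ 2^1+e∣ → odd⇒2∤ odd-q
  (*-cancelˡ-∣ (2 ^ e) {{m^n≢0 2 e}} (subst (_∣ 2 ^ e * q) (*-comm 2 (2 ^ e)) 2^1+e∣))

IsVal₂⇒oddPart : ∀ {X} e → IsVal₂ X e → ∃ λ q → odd q ≡ true × X ≡ 2 ^ e * q
IsVal₂⇒oddPart e (divides q X≡q*2^e , 2^1+e∤X) with odd q in odd-q
... | true  = q , odd-q , trans X≡q*2^e (*-comm q (2 ^ e))
... | false = ⊥-elim (2^1+e∤X (subst (2 ^ suc e ∣_) (sym X≡q*2^e) (*-monoˡ-∣ (2 ^ e) 2∣q)))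
  where
  2∣q : 2 ∣ q
  2∣q = divides (q / 2) (subst (λ b → q ≡ digit b + q / 2 * 2) odd-q (n≡odd+[n/2]*2 q))

oddFactorial : ℕ → ℕ
oddFactorial zero    = 1
oddFactorial (suc x) = suc (x * 2) * oddFactorial x

odd-oddFactorial : ∀ x → odd (oddFactorial x) ≡ true
odd-oddFactorial zero    = refl
odd-oddFactorial (suc x) =
  trans (odd-* (suc (x * 2)) (oddFactorial x)) (cong₂ _∧_ (odd[b+x*2]≡b true x) (odd-oddFactorial x))

[x*2]!≡2^x*x!*oddFactorial : ∀ x → (x * 2) ! ≡ 2 ^ x * (x ! * oddFactorial x)
[x*2]!≡2^x*x!*oddFactorial zero    = refl
[x*2]!≡2^x*x!*oddFactorial (suc x) =
  trans (cong (λ y → suc (suc (x * 2)) * (suc (x * 2) * y)) ([x*2]!≡2^x*x!*oddFactorial x))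
        (rearrange x (2 ^ x) (x !) (oddFactorial x))
  where
  rearrange : ∀ x P F O → (2 + x * 2) * ((1 + x * 2) * (P * (F * O)))
                        ≡ (2 * P) * (((1 + x) * F) * ((1 + x * 2) * O))
  rearrange = solve-∀

[b+x*2]!≡2^x*x!*oddFactorial : ∀ b x → (digit b + x * 2) ! ≡ 2 ^ x * (x ! * oddFactorial (digit b + x))
[b+x*2]!≡2^x*x!*oddFactorial false x = [x*2]!≡2^x*x!*oddFactorial x
[b+x*2]!≡2^x*x!*oddFactorial true  x =
  trans (cong (suc (x * 2) *_) ([x*2]!≡2^x*x!*oddFactorial x))
        (rearrange (suc (x * 2)) (2 ^ x) (x !) (oddFactorial x))
  where
  rearrange : ∀ y P F O → y * (P * (F * O)) ≡ P * (F * (y * O))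
  rearrange = solve-∀

IsVal₂-[b+x*2]! : ∀ b x {e} → IsVal₂ (x !) e → IsVal₂ ((digit b + x * 2) !) (x + e)
IsVal₂-[b+x*2]! b x {e} val with IsVal₂⇒oddPart e val
... | q , odd-q , x!≡2^e*q =
  subst (λ y → IsVal₂ y (x + e)) (sym factorisation)
        (IsVal₂-oddPart (x + e) {q * O} (trans (odd-* q O) (cong₂ _∧_ odd-q (odd-oddFactorial (digit b + x)))))
  where
  O = oddFactorial (digit b + x)
  rearrange : ∀ P Q q O → P * (Q * q * O) ≡ P * Q * (q * O)
  rearrange = solve-∀
  factorisation : (digit b + x * 2) ! ≡ 2 ^ (x + e) * (q * O)
  factorisation = begin
    (digit b + x * 2) !       ≡⟨ [b+x*2]!≡2^x*x!*oddFactorial b x ⟩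
    2 ^ x * (x ! * O)         ≡⟨ cong (λ y → 2 ^ x * (y * O)) x!≡2^e*q ⟩
    2 ^ x * (2 ^ e * q * O)   ≡⟨ rearrange (2 ^ x) (2 ^ e) q O ⟩
    2 ^ x * 2 ^ e * (q * O)   ≡⟨ cong (_* (q * O)) (sym (^-distribˡ-+-* 2 x e)) ⟩
    2 ^ (x + e) * (q * O)     ∎
    where open ≡-Reasoning

module FiniteAutomaton {State : Set} (states : List State) (∈-states : ∀ s → s ∈ states)
                       (start : State) (step : State → Bool × Bool → State) (accept : State → Bool) where

  encode : State → Fin (length states)
  encode s = index (∈-states s)

  decode : Fin (length states) → State
  decode = lookup states

  decode-encode : ∀ s → decode (encode s) ≡ s
  decode-encode s = sym (lookup-index (∈-states s))

  dfa : DFA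
  dfa = record
    { nStates = length states
    ; start   = encode start
    ; δ       = λ i x → encode (step (decode i) x)
    ; accept  = λ i → accept (decode i)
    }

  foldl-encode : ∀ w s → foldl (DFA.δ dfa) (encode s) w ≡ encode (foldl step s w)
  foldl-encode []      s = refl
  foldl-encode (x ∷ w) s = trans (cong (λ t → foldl (DFA.δ dfa) (encode (step t x)) w) (decode-encode s))
                                 (foldl-encode w (step s x))

  accepts-dfa : ∀ w → accepts dfa w ≡ accept (foldl step start w)
  accepts-dfa w = cong accept (trans (cong decode (foldl-encode w start)) (decode-encode _))

length-toBits : ∀ L n → length (toBits L n) ≡ L
length-toBits zero    n = refl
length-toBits (suc L) n =
  trans (length-++ (toBits L (n / 2))) (trans (+-comm _ 1) (cong suc (length-toBits L (n / 2))))

zip-∷ʳ : ∀ {A B : Set} (xs : List A) (ys : List B) x y → length xs ≡ length ys →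
         zip (xs ++ [ x ]) (ys ++ [ y ]) ≡ zip xs ys ++ [ (x , y) ]
zip-∷ʳ []       []       x y _  = refl
zip-∷ʳ (x′ ∷ xs) (y′ ∷ ys) x y eq = cong ((x′ , y′) ∷_) (zip-∷ʳ xs ys x y (suc-injective eq))

n<2^[1+L]⇒n/2<2^L : ∀ L {n} → n < 2 ^ suc L → n / 2 < 2 ^ L
n<2^[1+L]⇒n/2<2^L L {n} n< = m<n*o⇒m/o<n (subst (n <_) (*-comm 2 (2 ^ L)) n<)

module PairReading {State : Set} (step : State → Bool × Bool → State) (start : State) where

  run : ℕ → ℕ → ℕ → State
  run L n m = foldl step start (zip (toBits L n) (toBits L m))

  run-suc : ∀ L n m → run (suc L) n m ≡ step (run L (n / 2) (m / 2)) (odd n , odd m)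
  run-suc L n m = begin
    foldl step start (zip (toBits L (n / 2) ++ [ n % 2 ≡ᵇ 1 ]) (toBits L (m / 2) ++ [ m % 2 ≡ᵇ 1 ]))
      ≡⟨ cong (foldl step start) (zip-∷ʳ (toBits L (n / 2)) (toBits L (m / 2)) _ _
           (trans (length-toBits L (n / 2)) (sym (length-toBits L (m / 2))))) ⟩
    foldl step start (zip (toBits L (n / 2)) (toBits L (m / 2)) ++ [ ((n % 2 ≡ᵇ 1) , (m % 2 ≡ᵇ 1)) ])
      ≡⟨ foldl-++ step start (zip (toBits L (n / 2)) (toBits L (m / 2))) _ ⟩
    step (run L (n / 2) (m / 2)) ((n % 2 ≡ᵇ 1) , (m % 2 ≡ᵇ 1))
      ≡⟨ cong₂ (λ b e → step (run L (n / 2) (m / 2)) (b , e)) ([n%2≡ᵇ1]≡odd n) ([n%2≡ᵇ1]≡odd m) ⟩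
    step (run L (n / 2) (m / 2)) (odd n , odd m) ∎
    where open ≡-Reasoning

  run-invariant : (R : ℕ → ℕ → State → Set) → R 0 0 start →
                  (∀ {n m s} b e → R n m s → R (digit b + n * 2) (digit e + m * 2) (step s (b , e))) →
                  ∀ L {n m} → n < 2 ^ L → m < 2 ^ L → R n m (run L n m)
  run-invariant R R-start R-step zero n<1 m<1 rewrite n<1⇒n≡0 n<1 | n<1⇒n≡0 m<1 = R-start
  run-invariant R R-start R-step (suc L) {n} {m} n< m< =
    subst (R n m) (sym (run-suc L n m))
      (subst₂ (λ x y → R x y (step (run L (n / 2) (m / 2)) (odd n , odd m)))
        (sym (n≡odd+[n/2]*2 n)) (sym (n≡odd+[n/2]*2 m))
        (R-step (odd n) (odd m)
          (run-invariant R R-start R-step L (n<2^[1+L]⇒n/2<2^L L n<) (n<2^[1+L]⇒n/2<2^L L m<))))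

  run-determined : (R : ℕ → ℕ → State → Set) → (∀ {s} → R 0 0 s → s ≡ start) →
                   (∀ {n m s} → R n m s → ∃ λ s₀ → R (n / 2) (m / 2) s₀ × step s₀ (odd n , odd m) ≡ s) →
                   ∀ L {n m s} → n < 2 ^ L → m < 2 ^ L → R n m s → run L n m ≡ s
  run-determined R R-start R-previous zero n<1 m<1 R-s rewrite n<1⇒n≡0 n<1 | n<1⇒n≡0 m<1 = sym (R-start R-s)
  run-determined R R-start R-previous (suc L) {n} {m} n< m< R-s with R-previous R-s
  ... | s₀ , R-s₀ , step≡ = trans (run-suc L n m)
    (trans (cong (λ t → step t (odd n , odd m))
                 (run-determined R R-start R-previous L (n<2^[1+L]⇒n/2<2^L L n<) (n<2^[1+L]⇒n/2<2^L L m<) R-s₀))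
           step≡)

record Window : Set where
  constructor window
  field
    excess      : Fin 3
    high        : Bool
    low         : Bool
    blockParity : Bool

fromFields : Fin 3 × Bool × Bool × Bool → Window
fromFields (d , h , l , τ) = window d h l τ

bools : List Bool
bools = false ∷ true ∷ []

∈-bools : ∀ b → b ∈ bools
∈-bools false = here refl
∈-bools true  = there (here refl)

windows : List Window
windows = map fromFields (cartesianProduct (allFin 3) (cartesianProduct bools (cartesianProduct bools bools)))

∈-windows : ∀ w → w ∈ windows
∈-windows (window d h l τ) =
  ∈-map⁺ fromFields
    (∈-cartesianProduct⁺ (∈-allFin d)
      (∈-cartesianProduct⁺ (∈-bools h) (∈-cartesianProduct⁺ (∈-bools l) (∈-bools τ))))

states : List (Maybe Window)
states = nothing ∷ map just windows

∈-states : ∀ s → s ∈ states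
∈-states nothing  = here refl
∈-states (just w) = there (∈-map⁺ just (∈-windows w))

blockSum : Bool → Bool → Bool → ℕ
blockSum false false τ = digit τ
blockSum false true  τ = digit τ + digit τ
blockSum true  false τ = digit τ + digit τ + digit (not τ)
blockSum true  true  τ = digit τ + digit τ + digit (not τ) + digit (not τ)

blockSum-total : ∀ τ → blockSum true true τ ≡ 2
blockSum-total false = refl
blockSum-total true  = refl

blockSum<3 : ∀ h l τ → blockSum h l τ < 3
blockSum<3 h l τ = s≤s (≤-trans (blockSum-mono h l τ) (≤-reflexive (blockSum-total τ)))
  where
  blockSum-mono : ∀ h l τ → blockSum h l τ ≤ blockSum true true τ
  blockSum-mono false false τ = ≤-trans (m≤m+n _ _) (≤-trans (m≤m+n _ _) (m≤m+n _ _))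
  blockSum-mono false true  τ = ≤-trans (m≤m+n _ _) (m≤m+n _ _)
  blockSum-mono true  false τ = m≤m+n _ _
  blockSum-mono true  true  τ = ≤-refl

toExcess : ℕ → Maybe (Fin 3)
toExcess 0 = just 0F
toExcess 1 = just 1F
toExcess 2 = just 2F
toExcess _ = nothing

shiftExcess : Bool → ℕ → Maybe (Fin 3)
shiftExcess false k             = toExcess k
shiftExcess true  (suc (suc k)) = toExcess k
shiftExcess true  _             = nothing

shiftExcess-sound : ∀ h k {d} → shiftExcess h k ≡ just d → k ≡ toℕ d + digit h * 2
shiftExcess-sound false 0 refl = refl
shiftExcess-sound false 1 refl = refl
shiftExcess-sound false 2 refl = refl
shiftExcess-sound true  2 refl = refl
shiftExcess-sound true  3 refl = refl
shiftExcess-sound true  4 refl = refl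

shiftExcess-complete : ∀ h d → shiftExcess h (toℕ d + digit h * 2) ≡ just d
shiftExcess-complete false 0F = refl
shiftExcess-complete false 1F = refl
shiftExcess-complete false 2F = refl
shiftExcess-complete true  0F = refl
shiftExcess-complete true  1F = refl
shiftExcess-complete true  2F = refl

next : Window → Bool × Bool → Maybe Window
next (window d h l τ) (b , e) =
  Maybe.map (λ d′ → window d′ l b (h xor τ)) (shiftExcess h (digit e + toℕ d * 2))

step : Maybe Window → Bool × Bool → Maybe Window
step s x = s >>= λ w → next w x

start : Maybe Window
start = just (window 0F false false false)

accept : Maybe Window → Bool
accept nothing                  = false
accept (just (window d h l τ)) = toℕ d ≡ᵇ blockSum h l τ

predecessorExcess : Bool → Fin 3 → Fin 3
predecessorExcess false 0F = 0F
predecessorExcess false 1F = 0F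
predecessorExcess false 2F = 1F
predecessorExcess true  0F = 1F
predecessorExcess true  1F = 1F
predecessorExcess true  2F = 2F

excess-halves : ∀ s d → toℕ d + digit s * 2 ≡ digit (odd (toℕ d)) + toℕ (predecessorExcess s d) * 2
excess-halves false 0F = refl
excess-halves false 1F = refl
excess-halves false 2F = refl
excess-halves true  0F = refl
excess-halves true  1F = refl
excess-halves true  2F = refl

x+[y+a*2]*2≡x+y*2+a*4 : ∀ x y a → x + (y + a * 2) * 2 ≡ x + y * 2 + a * 4
x+[y+a*2]*2≡x+y*2+a*4 = solve-∀

excess-split : ∀ s d a →
  toℕ d + (digit s + a * 2) * 2 ≡ digit (odd (toℕ d)) + (toℕ (predecessorExcess s d) + a * 2) * 2
excess-split s d a = begin
  toℕ d + (digit s + a * 2) * 2    ≡⟨ x+[y+a*2]*2≡x+y*2+a*4 (toℕ d) (digit s) a ⟩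
  toℕ d + digit s * 2 + a * 4      ≡⟨ cong (_+ a * 4) (excess-halves s d) ⟩
  digit lo + toℕ d₀ * 2 + a * 4    ≡⟨ sym (x+[y+a*2]*2≡x+y*2+a*4 (digit lo) (toℕ d₀) a) ⟩
  digit lo + (toℕ d₀ + a * 2) * 2  ∎
  where
  open ≡-Reasoning
  lo = odd (toℕ d)
  d₀ = predecessorExcess s d

next-predecessor : ∀ s d h l τ →
  next (window (predecessorExcess s d) s h τ) (l , odd (toℕ d)) ≡ just (window d h l (s xor τ))
next-predecessor s d h l τ = cong (Maybe.map (λ d′ → window d′ h l (s xor τ)))
  (trans (cong (shiftExcess s) (sym (excess-halves s d))) (shiftExcess-complete s d))

open FiniteAutomaton states ∈-states start step accept using (dfa; accepts-dfa)
open PairReading step start using (run; run-invariant; run-determined)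

module ParitySum (γ : ℕ → ℕ) (γ-spec : Is2AdicValOfFactorial γ) where

  γ[b+x*2]≡x+γx : ∀ b x → γ (digit b + x * 2) ≡ x + γ x
  γ[b+x*2]≡x+γx b x = IsVal₂-unique (γ-spec _) (IsVal₂-[b+x*2]! b x (γ-spec x))

  γ0≡0 : γ 0 ≡ 0
  γ0≡0 = IsVal₂-unique (γ-spec 0) (IsVal₂-oddPart 0 {1} refl)

  -- As γ(a) = a − s₂(a), this is s₂(a) mod 2, the Thue–Morse sequence.
  thueMorse : ℕ → Bool
  thueMorse a = odd (a + γ a)

  thueMorse-0 : thueMorse 0 ≡ false
  thueMorse-0 = cong odd γ0≡0

  thueMorse-[b+x*2] : ∀ b x → thueMorse (digit b + x * 2) ≡ b xor thueMorse x
  thueMorse-[b+x*2] b x = begin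
    odd (n + γ n)                  ≡⟨ cong (λ g → odd (n + g)) (γ[b+x*2]≡x+γx b x) ⟩
    odd (n + (x + γ x))            ≡⟨ odd-+ n (x + γ x) ⟩
    odd n xor thueMorse x          ≡⟨ cong (_xor thueMorse x) (odd[b+x*2]≡b b x) ⟩
    b xor thueMorse x              ∎
    where
    open ≡-Reasoning
    n = digit b + x * 2

  γ%2-block : ∀ a h l → γ (digit l + (digit h + a * 2) * 2) % 2 ≡ digit (h xor thueMorse a)
  γ%2-block a h l = begin
    γ n % 2                              ≡⟨ n%2≡digit∘odd (γ n) ⟩
    digit (odd (γ n))                    ≡⟨ cong (λ g → digit (odd g)) (γ[b+x*2]≡x+γx l (digit h + a * 2)) ⟩
    digit (thueMorse (digit h + a * 2))  ≡⟨ cong digit (thueMorse-[b+x*2] h a) ⟩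
    digit (h xor thueMorse a)            ∎
    where
    open ≡-Reasoning
    n = digit l + (digit h + a * 2) * 2

  sum : ℕ → ℕ
  sum = runningSum (λ i → γ i % 2)

  sum-suc : ∀ {n c x} a → sum n ≡ c + a * 2 → γ (suc n) % 2 ≡ x → sum (suc n) ≡ c + x + a * 2
  sum-suc {c = c} {x} a sum≡ γ≡ = trans (cong₂ _+_ sum≡ γ≡) (swap c (a * 2) x)
    where
    swap : ∀ c y x → c + y + x ≡ c + x + y
    swap = solve-∀

  sum-within : ∀ a → sum (a * 2 * 2) ≡ blockSum false false (thueMorse a) + a * 2 →
               ∀ h l → sum (digit l + (digit h + a * 2) * 2) ≡ blockSum h l (thueMorse a) + a * 2
  sum-within a sum₀ = λ where
      false false → sum₀
      false true  → sum₁
      true  false → sum₂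
      true  true  → sum₃
    where
    τ = thueMorse a
    sum₁ : sum (1 + a * 2 * 2) ≡ blockSum false true τ + a * 2
    sum₁ = sum-suc a sum₀ (γ%2-block a false true)
    sum₂ : sum (2 + a * 2 * 2) ≡ blockSum true false τ + a * 2
    sum₂ = sum-suc a sum₁ (γ%2-block a true false)
    sum₃ : sum (3 + a * 2 * 2) ≡ blockSum true true τ + a * 2
    sum₃ = sum-suc a sum₂ (γ%2-block a true true)

  sum-blockStart : ∀ a → sum (a * 2 * 2) ≡ digit (thueMorse a) + a * 2
  sum-blockStart zero    = trans (γ%2-block 0 false false) (sym (+-identityʳ _))
  sum-blockStart (suc a) = begin
    sum (3 + a * 2 * 2) + γ (suc a * 2 * 2) % 2
      ≡⟨ cong₂ _+_ (sum-within a (sum-blockStart a) true true) (γ%2-block (suc a) false false) ⟩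
    blockSum true true (thueMorse a) + a * 2 + digit (thueMorse (suc a))
      ≡⟨ cong (λ c → c + a * 2 + digit (thueMorse (suc a))) (blockSum-total (thueMorse a)) ⟩
    2 + a * 2 + digit (thueMorse (suc a))
      ≡⟨ +-comm (2 + a * 2) _ ⟩
    digit (thueMorse (suc a)) + suc a * 2 ∎
    where open ≡-Reasoning

  sum-block : ∀ a h l → sum (digit l + (digit h + a * 2) * 2) ≡ blockSum h l (thueMorse a) + a * 2
  sum-block a = sum-within a (sum-blockStart a)

  Describes : ℕ → ℕ → Window → Set
  Describes n m (window d h l τ) =
    ∃ λ a → n ≡ digit l + (digit h + a * 2) * 2 × m ≡ toℕ d + a * 2 × τ ≡ thueMorse a

  Describes-start : All (Describes 0 0) start
  Describes-start = just (0 , refl , refl , sym thueMorse-0)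

  Describes-origin : ∀ {w} → Describes 0 0 w → just w ≡ start
  Describes-origin {window 0F false false τ} (zero , _ , _ , τ≡) =
    cong (λ t → just (window 0F false false t)) (trans τ≡ thueMorse-0)
  Describes-origin {window 1F _ _ _} (zero , _ , () , _)
  Describes-origin {window 2F _ _ _} (zero , _ , () , _)
  Describes-origin {window _ _ true _} (_ , () , _ , _)
  Describes-origin {window _ true false _} (_ , () , _ , _)
  Describes-origin {window _ false false _} (suc _ , () , _ , _)

  next-Describes : ∀ {n m w} b e → Describes n m w →
                   All (Describes (digit b + n * 2) (digit e + m * 2)) (next w (b , e))
  next-Describes {m = m} {w = window d h l τ} b e (a , n≡ , m≡ , τ≡)
    with shiftExcess h (digit e + toℕ d * 2) in shift≡
  ... | nothing = nothing
  ... | just d′ = just (digit h + a * 2 , cong (λ x → digit b + x * 2) n≡ , m′≡ , τ′≡)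
    where
    m′≡ : digit e + m * 2 ≡ toℕ d′ + (digit h + a * 2) * 2
    m′≡ = begin
      digit e + m * 2                 ≡⟨ cong (λ x → digit e + x * 2) m≡ ⟩
      digit e + (toℕ d + a * 2) * 2   ≡⟨ x+[y+a*2]*2≡x+y*2+a*4 (digit e) (toℕ d) a ⟩
      digit e + toℕ d * 2 + a * 4     ≡⟨ cong (_+ a * 4) (shiftExcess-sound h _ shift≡) ⟩
      toℕ d′ + digit h * 2 + a * 4    ≡⟨ sym (x+[y+a*2]*2≡x+y*2+a*4 (toℕ d′) (digit h) a) ⟩
      toℕ d′ + (digit h + a * 2) * 2  ∎
      where open ≡-Reasoning
    τ′≡ : h xor τ ≡ thueMorse (digit h + a * 2)
    τ′≡ = trans (cong (h xor_) τ≡) (sym (thueMorse-[b+x*2] h a))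

  step-Describes : ∀ {n m s} b e → All (Describes n m) s →
                   All (Describes (digit b + n * 2) (digit e + m * 2)) (step s (b , e))
  step-Describes b e nothing  = nothing
  step-Describes {s = just w} b e (just D) = next-Describes {w = w} b e D

  Describes-previous : ∀ {n m w} → Describes n m w →
                       ∃ λ w₀ → Describes (n / 2) (m / 2) w₀ × next w₀ (odd n , odd m) ≡ just w
  Describes-previous {n} {m} {window d h l τ} (a , n≡ , m≡ , τ≡) =
    window d₀ s h (thueMorse a₀) , (a₀ , proj₁ n-halves , proj₁ m-halves , refl) , next≡
    where
    s = odd a
    a₀ = a / 2
    d₀ = predecessorExcess s d
    a≡ : a ≡ digit s + a₀ * 2
    a≡ = n≡odd+[n/2]*2 a
    n-halves : n / 2 ≡ digit h + (digit s + a₀ * 2) * 2 × odd n ≡ l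
    n-halves = halving-unique l _ (trans n≡ (cong (λ x → digit l + (digit h + x * 2) * 2) a≡))
    m-halves : m / 2 ≡ toℕ d₀ + a₀ * 2 × odd m ≡ odd (toℕ d)
    m-halves = halving-unique (odd (toℕ d)) _
      (trans m≡ (trans (cong (λ x → toℕ d + x * 2) a≡) (excess-split s d a₀)))
    τ≡s⊕t₀ : τ ≡ s xor thueMorse a₀
    τ≡s⊕t₀ = trans τ≡ (trans (cong thueMorse a≡) (thueMorse-[b+x*2] s a₀))
    next≡ : next (window d₀ s h (thueMorse a₀)) (odd n , odd m) ≡ just (window d h l τ)
    next≡ = begin
      next (window d₀ s h (thueMorse a₀)) (odd n , odd m)
        ≡⟨ cong₂ (λ b e → next (window d₀ s h (thueMorse a₀)) (b , e)) (proj₂ n-halves) (proj₂ m-halves) ⟩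
      next (window d₀ s h (thueMorse a₀)) (l , odd (toℕ d))
        ≡⟨ next-predecessor s d h l (thueMorse a₀) ⟩
      just (window d h l (s xor thueMorse a₀))
        ≡⟨ cong (λ t → just (window d h l t)) (sym τ≡s⊕t₀) ⟩
      just (window d h l τ) ∎
      where open ≡-Reasoning

  Any-Describes-origin : ∀ {s} → Any (Describes 0 0) s → s ≡ start
  Any-Describes-origin (just D) = Describes-origin D

  Any-Describes-previous : ∀ {n m s} → Any (Describes n m) s →
                           ∃ λ s₀ → Any (Describes (n / 2) (m / 2)) s₀ × step s₀ (odd n , odd m) ≡ s
  Any-Describes-previous (just D) with Describes-previous D
  ... | w₀ , D₀ , next≡ = just w₀ , just D₀ , next≡

  accept-sound : ∀ {n m s} → All (Describes n m) s → accept s ≡ true → m ≡ sum n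
  accept-sound {n} {m} {just (window d h l τ)} (just (a , n≡ , m≡ , τ≡)) accepted = begin
    m                                      ≡⟨ m≡ ⟩
    toℕ d + a * 2                          ≡⟨ cong (_+ a * 2) (≡ᵇ⇒≡ _ _ (Equivalence.from T-≡ accepted)) ⟩
    blockSum h l τ + a * 2                 ≡⟨ cong (λ t → blockSum h l t + a * 2) τ≡ ⟩
    blockSum h l (thueMorse a) + a * 2     ≡⟨ sym (sum-block a h l) ⟩
    sum (digit l + (digit h + a * 2) * 2)  ≡⟨ cong sum (sym n≡) ⟩
    sum n                                  ∎
    where open ≡-Reasoning

  Describes-graph : ∀ n → ∃ λ w → Describes n (sum n) w × accept (just w) ≡ true
  Describes-graph n =
    window d h l τ , (a , n≡ , m≡ , refl) , Equivalence.to T-≡ (≡⇒≡ᵇ (toℕ d) (blockSum h l τ) (toℕ-fromℕ< _))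
    where
    l = odd n
    h = odd (n / 2)
    a = n / 2 / 2
    τ = thueMorse a
    d = fromℕ< (blockSum<3 h l τ)
    n≡ : n ≡ digit l + (digit h + a * 2) * 2
    n≡ = trans (n≡odd+[n/2]*2 n) (cong (λ x → digit l + x * 2) (n≡odd+[n/2]*2 (n / 2)))
    m≡ : sum n ≡ toℕ d + a * 2
    m≡ = trans (cong sum n≡) (trans (sum-block a h l) (cong (_+ a * 2) (sym (toℕ-fromℕ< _))))

  accepts⇒graph : ∀ n m → accepts dfa (pairWord n m) ≡ true → m ≡ sum n
  accepts⇒graph n m accepted = accept-sound
    (run-invariant (λ n m → All (Describes n m)) Describes-start step-Describes L n< m<)
    (trans (sym (accepts-dfa (pairWord n m))) accepted)
    where
    L = bitLength n ⊔ bitLength m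
    n< = proj₁ (padded-bounds n m)
    m< = proj₂ (padded-bounds n m)

  graph⇒accepts : ∀ n m → m ≡ sum n → accepts dfa (pairWord n m) ≡ true
  graph⇒accepts n m refl with Describes-graph n
  ... | w , D , accepted = begin
    accepts dfa (pairWord n m) ≡⟨ accepts-dfa (pairWord n m) ⟩
    accept (run L n m)          ≡⟨ cong accept (run-determined (λ n m → Any (Describes n m))
                                     Any-Describes-origin Any-Describes-previous L n< m< (just {x = w} D)) ⟩
    accept (just w)             ≡⟨ accepted ⟩
    true                        ∎
    where
    open ≡-Reasoning
    L = bitLength n ⊔ bitLength m
    n< = proj₁ (padded-bounds n m)
    m< = proj₂ (padded-bounds n m)

mainTheorem12 : (γ : ℕ → ℕ) → Is2AdicValOfFactorial γ →
                  Synchronised₂ (runningSum (λ i → γ i % 2))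
mainTheorem12 γ γ-spec = dfa , λ n m → accepts⇒graph n m , graph⇒accepts n m
  where open ParitySum γ γ-spec
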